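{- Let $n>c_1\ge c_2$ and $\Sigma$ be natural numbers and let $D=(d_1,\dots,d_n)\in\mathcal D(n,\Sigma,c_1,c_2)$. Then for every $k\in\{1,\dots,n\}$ with $k\le c_2$ or $k>c_1$, the inequality $\sum_{i=1}^k d_i\le k(k-1)+\sum_{i=k+1}^n\min(d_i,k)$ holds.
   Context: $\mathcal D(n,\Sigma,c_1,c_2)$ is the set of integer sequences $(d_1,\dots,d_n)$ with $c_1\ge d_1\ge\dots\ge d_n\ge c_2$, $\sum_i d_i$ even, and $\sum_i d_i=\Sigma$. -}

module Defs where

open import Data.Nat using (ℕ; zero; suc; _+_; _*_; _∸_; _≤_; _<_; _⊓_; _<ᵇ_)
open import Data.Nat.Divisibility using (_∣_)
open import Data.Fin using (Fin; toℕ; suc; zero)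
open import Data.Bool using (if_then_else_)
open import Data.Product using (_×_)
open import Relation.Binary.PropositionalEquality using (_≡_)

-- Degree sequences d = (d_1,…,d_n) are modelled as functions Fin n → ℕ;
-- position i : Fin n (0-based) stands for index toℕ i + 1.

∑ : ∀ {n} → (Fin n → ℕ) → ℕ
∑ {zero}  f = 0
∑ {suc n} f = f zero + ∑ (λ i → f (suc i))

sumFirst : ∀ {n} → ℕ → (Fin n → ℕ) → ℕ
sumFirst k d = ∑ (λ i → if toℕ i <ᵇ k then d i else 0)

sumMinRest : ∀ {n} → ℕ → (Fin n → ℕ) → ℕ
sumMinRest k d = ∑ (λ i → if toℕ i <ᵇ k then 0 else (d i ⊓ k))

record InD (n Σ' c₁ c₂ : ℕ) (d : Fin n → ℕ) : Set where
  field
    upper      : ∀ i → d i ≤ c₁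
    lower      : ∀ i → c₂ ≤ d i
    nonincr    : ∀ (i j : Fin n) → toℕ i ≤ toℕ j → d j ≤ d i
    sumEven    : 2 ∣ ∑ d
    sumIsΣ     : ∑ d ≡ Σ'

{-# OPTIONS --safe #-}
-- The first k terms are each at most c₁, so their sum is at most k c₁.  If c₁ < k this is
-- already at most k(k − 1).  If k ≤ c₂, every later term satisfies min(dᵢ, k) = k, so the
-- right-hand side is at least k(k − 1) + (n − k) k = k(n − 1) ≥ k c₁.
module Submission where

open import Defs
open import Data.Nat using (ℕ; zero; suc; _+_; _*_; _∸_; _≤_; _<_; _⊓_; _<ᵇ_; z≤n; s≤s)
open import Data.Nat.Properties
open import Data.Sum using (_⊎_; inj₁; inj₂)
open import Data.Fin using (Fin; toℕ; zero; suc)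
open import Data.Bool using (if_then_else_)
open import Relation.Binary.PropositionalEquality using (_≡_; sym; cong)

sumFrom : ∀ {n} → ℕ → (Fin n → ℕ) → ℕ
sumFrom k g = ∑ (λ i → if toℕ i <ᵇ k then 0 else g i)

sumFirst-≤-* : ∀ {n} k c (f : Fin n → ℕ) → (∀ i → f i ≤ c) → sumFirst k f ≤ k * c
sumFirst-≤-* {zero}  k       c f f≤c = z≤n
sumFirst-≤-* {suc n} zero    c f f≤c = sumFirst-≤-* zero c (λ i → f (suc i)) (λ i → f≤c (suc i))
sumFirst-≤-* {suc n} (suc k) c f f≤c =
  +-mono-≤ (f≤c zero) (sumFirst-≤-* k c (λ i → f (suc i)) (λ i → f≤c (suc i)))

*-≤-sumFrom : ∀ {n} k m (g : Fin n → ℕ) → (∀ i → m ≤ g i) → (n ∸ k) * m ≤ sumFrom k g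
*-≤-sumFrom {zero}  k       m g m≤g rewrite 0∸n≡0 k = z≤n
*-≤-sumFrom {suc n} zero    m g m≤g =
  +-mono-≤ (m≤g zero) (*-≤-sumFrom zero m (λ i → g (suc i)) (λ i → m≤g (suc i)))
*-≤-sumFrom {suc n} (suc k) m g m≤g = *-≤-sumFrom k m (λ i → g (suc i)) (λ i → m≤g (suc i))

*-≤-sumMinRest : ∀ {n} k c (d : Fin n → ℕ) → k ≤ c → (∀ i → c ≤ d i) →
  (n ∸ k) * k ≤ sumMinRest k d
*-≤-sumMinRest k c d k≤c c≤d =
  *-≤-sumFrom k k (λ i → d i ⊓ k) (λ i → ⊓-glb (≤-trans k≤c (c≤d i)) ≤-refl)

m<n⇒m≤n∸1 : ∀ {m n} → m < n → m ≤ n ∸ 1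
m<n⇒m≤n∸1 (s≤s m≤n) = m≤n

n∸1≡[k∸1]+[n∸k] : ∀ {k n} → 1 ≤ k → k ≤ n → n ∸ 1 ≡ (k ∸ 1) + (n ∸ k)
n∸1≡[k∸1]+[n∸k] {suc a} (s≤s z≤n) (s≤s a≤n) = sym (m+[n∸m]≡n a≤n)

proposition2p2 : (n c₁ c₂ Σ' : ℕ) → c₁ < n → c₂ ≤ c₁ →
    (d : Fin n → ℕ) → InD n Σ' c₁ c₂ d →
    (k : ℕ) → 1 ≤ k → k ≤ n → (k ≤ c₂ ⊎ c₁ < k) →
    sumFirst k d ≤ k * (k ∸ 1) + sumMinRest k d
proposition2p2 n c₁ c₂ Σ' c₁<n _ d D k 1≤k k≤n (inj₂ c₁<k) = begin
  sumFirst k d                  ≤⟨ sumFirst-≤-* k c₁ d (InD.upper D) ⟩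
  k * c₁                        ≤⟨ *-monoʳ-≤ k (m<n⇒m≤n∸1 c₁<k) ⟩
  k * (k ∸ 1)                   ≤⟨ m≤m+n _ _ ⟩
  k * (k ∸ 1) + sumMinRest k d  ∎
  where open ≤-Reasoning
proposition2p2 n c₁ c₂ Σ' c₁<n _ d D k 1≤k k≤n (inj₁ k≤c₂) = begin
  sumFirst k d                  ≤⟨ sumFirst-≤-* k c₁ d (InD.upper D) ⟩
  k * c₁                        ≤⟨ *-monoʳ-≤ k (m<n⇒m≤n∸1 c₁<n) ⟩
  k * (n ∸ 1)                   ≡⟨ cong (k *_) (n∸1≡[k∸1]+[n∸k] 1≤k k≤n) ⟩
  k * ((k ∸ 1) + (n ∸ k))       ≡⟨ *-distribˡ-+ k (k ∸ 1) (n ∸ k) ⟩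
  k * (k ∸ 1) + k * (n ∸ k)     ≡⟨ cong (k * (k ∸ 1) +_) (*-comm k (n ∸ k)) ⟩
  k * (k ∸ 1) + (n ∸ k) * k     ≤⟨ +-monoʳ-≤ (k * (k ∸ 1)) (*-≤-sumMinRest k c₂ d k≤c₂ (InD.lower D)) ⟩
  k * (k ∸ 1) + sumMinRest k d  ∎
  where open ≤-Reasoning
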